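{- Let $R$ be a p.q.-Baer $*$-ring. If $|CP(R)|=4$, then $\Gamma^*_s(R)$ is complete bipartite, and hence $\Gamma^*_s(R)^c$ is disconnected.
   Context: A $*$-ring is a ring $R$ with an involution $x\mapsto x^*$. A projection is an element $e$ with $e^2=e=e^*$; a central projection is a projection in the centre of $R$; $CP(R)$ is the set of central projections. For $S\subseteq R$, $r_R(S)=\{x\in R: sx=0\ \forall s\in S\}$. $R$ is a p.q.-Baer $*$-ring if for every $a\in R$, $r_R(aR)=eR$ for some projection $e\in R$. The strong zero-divisor graph $\Gamma^*_s(R)$ is the simple undirected graph with vertex set $\{0\neq a\in R: r_R(aR)\neq\{0\}\}$, distinct vertices $a,b$ adjacent iff $aRb^*=0$. The complement $G^c$ of a simple graph $G$ has the same vertices, distinct vertices adjacent iff not adjacent in $G$. -}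

module Defs where

open import Level using (Level; _⊔_) renaming (suc to lsuc)
open import Algebra.Bundles using (Ring)
open import Data.Fin using (Fin)
open import Data.Product using (Σ; ∃; _×_; _,_; proj₁)
open import Data.Sum using (_⊎_)
open import Data.Empty using (⊥)
open import Relation.Nullary using (¬_)
open import Relation.Binary.PropositionalEquality using (_≡_)
open import Function.Bundles using (_⇔_)

record StarRing (c ℓ : Level) : Set (lsuc (c ⊔ ℓ)) where
  field
    ring : Ring c ℓ
  open Ring ring public
  field
    _⋆        : Carrier → Carrier
    ⋆-cong    : ∀ {x y} → x ≈ y → (x ⋆) ≈ (y ⋆)
    ⋆-+       : ∀ x y → ((x + y) ⋆) ≈ ((x ⋆) + (y ⋆))
    ⋆-*       : ∀ x y → ((x * y) ⋆) ≈ ((y ⋆) * (x ⋆))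
    ⋆-invol   : ∀ x → ((x ⋆) ⋆) ≈ x
  infix 8 _⋆

module _ {c ℓ : Level} (R : StarRing c ℓ) where
  open StarRing R

  IsProjection : Carrier → Set ℓ
  IsProjection e = (e * e ≈ e) × (e ⋆ ≈ e)

  IsCentralProjection : Carrier → Set (c ⊔ ℓ)
  IsCentralProjection e = IsProjection e × (∀ x → e * x ≈ x * e)

  -- x ∈ r_R(aR)  (i.e. s x = 0 for all s = a r ∈ aR)
  InRAnnAR : Carrier → Carrier → Set (c ⊔ ℓ)
  InRAnnAR a x = ∀ r → (a * r) * x ≈ 0#

  InPrincipal : Carrier → Carrier → Set (c ⊔ ℓ)
  InPrincipal e x = ∃ λ y → x ≈ e * y

  IsPQBaer : Set (c ⊔ ℓ)
  IsPQBaer = ∀ a → ∃ λ e → IsProjection e ×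
               (∀ x → (InRAnnAR a x ⇔ InPrincipal e x))

  CPHasFourElements : Set (c ⊔ ℓ)
  CPHasFourElements =
    Σ (Fin 4 → Carrier) λ f →
      (∀ i → IsCentralProjection (f i)) ×
      (∀ i j → f i ≈ f j → i ≡ j) ×
      (∀ e → IsCentralProjection e → ∃ λ i → e ≈ f i)

record Graph (a ℓ e : Level) : Set (lsuc (a ⊔ ℓ ⊔ e)) where
  field
    V    : Set a
    _≈ᵥ_ : V → V → Set ℓ
    E    : V → V → Set e

module _ {a ℓ e : Level} (G : Graph a ℓ e) where
  open Graph G

  IsCompleteBipartite : Set (lsuc (a ⊔ ℓ) ⊔ a ⊔ ℓ ⊔ e)
  IsCompleteBipartite =
    Σ (V → Set (a ⊔ ℓ)) λ V₁ → Σ (V → Set (a ⊔ ℓ)) λ V₂ →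
      (∀ {u v} → u ≈ᵥ v → V₁ u → V₁ v) ×
      (∀ {u v} → u ≈ᵥ v → V₂ u → V₂ v) ×
      (∃ V₁) × (∃ V₂) ×
      (∀ v → V₁ v ⊎ V₂ v) ×
      (∀ v → V₁ v → V₂ v → ⊥) ×
      (∀ u v → (E u v ⇔ ((V₁ u × V₂ v) ⊎ (V₂ u × V₁ v))))

  data Walk : V → V → Set (a ⊔ ℓ ⊔ e) where
    here : ∀ {u v} → u ≈ᵥ v → Walk u v
    step : ∀ {u w v} → E u w → Walk w v → Walk u v

  IsDisconnected : Set (a ⊔ ℓ ⊔ e)
  IsDisconnected = ∃ λ u → ∃ λ v → ¬ Walk u v

complement : ∀ {a ℓ e} → Graph a ℓ e → Graph a ℓ (ℓ ⊔ e)
complement G = record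
  { V = V ; _≈ᵥ_ = _≈ᵥ_ ; E = λ u v → (¬ (u ≈ᵥ v)) × (¬ E u v) }
  where open Graph G

module _ {c ℓ : Level} (R : StarRing c ℓ) where
  open StarRing R

  IsVertex : Carrier → Set (c ⊔ ℓ)
  IsVertex a = (¬ (a ≈ 0#)) × (∃ λ x → (¬ (x ≈ 0#)) × InRAnnAR R a x)

  strongZDGraph : Graph (c ⊔ ℓ) ℓ (c ⊔ ℓ)
  strongZDGraph = record
    { V    = Σ Carrier IsVertex
    ; _≈ᵥ_ = λ u v → proj₁ u ≈ proj₁ v
    ; E    = λ u v → (¬ (proj₁ u ≈ proj₁ v)) ×
                     (∀ r → (proj₁ u * r) * (proj₁ v ⋆) ≈ 0#)
    }

{-# OPTIONS --safe #-}

-- In a p.q.-Baer *-ring the projection g with r(aR) = gR is central: r(aR) is a left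
-- ideal, so Rg ⊆ gR, and a left semicentral projection is central. If CP(R) has four elements it is
-- {0, 1, e, 1 - e} for some e ∉ {0, 1}, and for a vertex a the generator g is neither 0
-- (r(aR) ≠ 0) nor 1 (a ≠ 0); so r(aR) is eR or (1 - e)R, and these two classes are the
-- parts. If r(uR) = eR, then uRv⋆ = 0 means v⋆ ∈ eR, i.e. v(1 - e) = 0, i.e. v lies in the
-- other part. Walks in the complement of a complete bipartite graph never leave a part.

module Submission where

open import Defs
open import Level using (Level; _⊔_)
open import Data.Empty using (⊥)
open import Data.Fin as Fin using (Fin; zero; suc; _≟_)
open import Data.Fin.Properties using (injective⇒≤)
open import Data.List using (List; []; _∷_; length; lookup)
open import Data.List.Membership.Propositional using (_∈_)
open import Data.List.Membership.Propositional.Properties using (∈-lookup)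
import Data.List.Relation.Unary.All as All
open import Data.List.Relation.Unary.All using ([]; _∷_)
open import Data.List.Relation.Unary.All.Properties using (¬Any⇒All¬)
open import Data.List.Relation.Unary.AllPairs using ([]; _∷_)
open import Data.List.Relation.Unary.Any using (here; there)
open import Data.List.Relation.Unary.Unique.Propositional using (Unique)
open import Data.Nat as ℕ using (ℕ; _≤_)
open import Data.Nat.Properties using (<-irrefl)
open import Data.Product using (Σ; ∃; _×_; _,_; proj₁; proj₂)
open import Data.Sum using (_⊎_; inj₁; inj₂)
open import Function.Base using (_∘_)
open import Function.Bundles using (_⇔_; mk⇔; Equivalence)
import Function.Properties.Equivalence as ⇔
open import Relation.Nullary using (¬_; yes; no; contradiction)
open import Relation.Binary.PropositionalEquality as ≡ using (_≡_; _≢_; cong; ≢-sym)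

lookup-injective : ∀ {a} {A : Set a} {xs : List A} → Unique xs →
                   ∀ {i j} → lookup xs i ≡ lookup xs j → i ≡ j
lookup-injective (_    ∷ _)   {zero}  {zero}  _     = ≡.refl
lookup-injective (x∉xs ∷ _)   {zero}  {suc j} x≡xⱼ  =
  contradiction x≡xⱼ (All.lookup x∉xs (∈-lookup j))
lookup-injective (x∉xs ∷ _)   {suc i} {zero}  xᵢ≡x  =
  contradiction (≡.sym xᵢ≡x) (All.lookup x∉xs (∈-lookup i))
lookup-injective (_    ∷ xs!) {suc i} {suc j} xᵢ≡xⱼ = cong suc (lookup-injective xs! xᵢ≡xⱼ)

module _ {n : ℕ} where
  open import Data.List.Membership.DecPropositional (_≟_ {n}) using (_∈?_)

  unique⇒length≤ : {xs : List (Fin n)} → Unique xs → length xs ≤ n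
  unique⇒length≤ xs! = injective⇒≤ (lookup-injective xs!)

  unique-full⇒∈ : {xs : List (Fin n)} → Unique xs → length xs ≡ n → ∀ m → m ∈ xs
  unique-full⇒∈ {xs} xs! full m with m ∈? xs
  ... | yes m∈xs = m∈xs
  ... | no  m∉xs = contradiction (unique⇒length≤ (¬Any⇒All¬ xs m∉xs ∷ xs!)) (<-irrefl full)

avoid₂ : ∀ {n} (i j : Fin (3 ℕ.+ n)) → ∃ λ k → k ≢ i × k ≢ j
avoid₂ zero                zero                = suc zero       , (λ ()) , (λ ())
avoid₂ zero                (suc zero)          = suc (suc zero) , (λ ()) , (λ ())
avoid₂ zero                (suc (suc _))       = suc zero       , (λ ()) , (λ ())
avoid₂ (suc zero)          zero                = suc (suc zero) , (λ ()) , (λ ())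
avoid₂ (suc zero)          (suc zero)          = zero           , (λ ()) , (λ ())
avoid₂ (suc zero)          (suc (suc _))       = zero           , (λ ()) , (λ ())
avoid₂ (suc (suc _))       zero                = suc zero       , (λ ()) , (λ ())
avoid₂ (suc (suc _))       (suc zero)          = zero           , (λ ()) , (λ ())
avoid₂ (suc (suc _))       (suc (suc _))       = zero           , (λ ()) , (λ ())

module _ {a ℓ e} (G : Graph a ℓ e) where
  open Graph G

  completeBipartite⇒complement-disconnected :
    IsCompleteBipartite G → IsDisconnected (complement G)
  completeBipartite⇒complement-disconnected
    (V₁ , V₂ , V₁-resp , _ , (u , u∈V₁) , (v , v∈V₂) , cover , disjoint , adjacent) =
    u , v , λ walk → disjoint v (stays-in-V₁ walk u∈V₁) v∈V₂
    where
    stays-in-V₁ : ∀ {x y} → Walk (complement G) x y → V₁ x → V₁ y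
    stays-in-V₁ (here x≈y) x∈V₁ = V₁-resp x≈y x∈V₁
    stays-in-V₁ (step {u = x} {w = w} (_ , ¬xw) walk) x∈V₁ with cover w
    ... | inj₁ w∈V₁ = stays-in-V₁ walk w∈V₁
    ... | inj₂ w∈V₂ =
      contradiction (Equivalence.from (adjacent x w) (inj₁ (x∈V₁ , w∈V₂))) ¬xw

module _ {c ℓ : Level} (R : StarRing c ℓ) where
  open StarRing R
  open import Algebra.Properties.Ring ring
    using (-0#≈0#; x+x≈x⇒x≈0; +-inverseʳ-unique; x[y-z]≈xy-xz; [y-z]x≈yx-zx)
  open import Relation.Binary.Reasoning.Setoid setoid

  0#⋆≈0# : 0# ⋆ ≈ 0#
  0#⋆≈0# = x+x≈x⇒x≈0 (0# ⋆) (trans (sym (⋆-+ 0# 0#)) (⋆-cong (+-identityʳ 0#)))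

  1#⋆≈1# : 1# ⋆ ≈ 1#
  1#⋆≈1# = begin
    1# ⋆                ≈⟨ *-identityʳ (1# ⋆) ⟨
    1# ⋆ * 1#           ≈⟨ *-congˡ (⋆-invol 1#) ⟨
    1# ⋆ * ((1# ⋆) ⋆)   ≈⟨ ⋆-* (1# ⋆) 1# ⟨
    (1# ⋆ * 1#) ⋆       ≈⟨ ⋆-cong (*-identityʳ (1# ⋆)) ⟩
    (1# ⋆) ⋆            ≈⟨ ⋆-invol 1# ⟩
    1#                  ∎

  -‿⋆ : ∀ x → (- x) ⋆ ≈ - (x ⋆)
  -‿⋆ x = +-inverseʳ-unique (x ⋆) ((- x) ⋆) (begin
    x ⋆ + (- x) ⋆       ≈⟨ ⋆-+ x (- x) ⟨
    (x + - x) ⋆         ≈⟨ ⋆-cong (-‿inverseʳ x) ⟩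
    0# ⋆                ≈⟨ 0#⋆≈0# ⟩
    0#                  ∎)

  0≈1⇒x≈0 : 0# ≈ 1# → ∀ x → x ≈ 0#
  0≈1⇒x≈0 0≈1 x = begin
    x        ≈⟨ *-identityʳ x ⟨
    x * 1#   ≈⟨ *-congˡ 0≈1 ⟨
    x * 0#   ≈⟨ zeroʳ x ⟩
    0#       ∎

  ⋆-*-selfAdjointʳ : ∀ {h} → h ⋆ ≈ h → ∀ x → (x * h) ⋆ ≈ h * x ⋆
  ⋆-*-selfAdjointʳ h⋆≈h x = trans (⋆-* x _) (*-congʳ h⋆≈h)

  ⋆-*-selfAdjointˡ : ∀ {h} → h ⋆ ≈ h → ∀ x → (h * x) ⋆ ≈ x ⋆ * h
  ⋆-*-selfAdjointˡ h⋆≈h x = trans (⋆-* _ x) (*-congˡ h⋆≈h)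

  x≈xh⇔x⋆≈hx⋆ : ∀ {h} → h ⋆ ≈ h → ∀ x → x ≈ x * h ⇔ x ⋆ ≈ h * x ⋆
  x≈xh⇔x⋆≈hx⋆ {h} h⋆≈h x = mk⇔
    (λ x≈xh → trans (⋆-cong x≈xh) (⋆-*-selfAdjointʳ h⋆≈h x))
    (λ x⋆≈hx⋆ → begin
      x                 ≈⟨ ⋆-invol x ⟨
      (x ⋆) ⋆           ≈⟨ ⋆-cong x⋆≈hx⋆ ⟩
      (h * x ⋆) ⋆       ≈⟨ ⋆-*-selfAdjointˡ h⋆≈h (x ⋆) ⟩
      (x ⋆) ⋆ * h       ≈⟨ *-congʳ (⋆-invol x) ⟩
      x * h             ∎)

  IsCentralProjection-0# : IsCentralProjection R 0#
  IsCentralProjection-0# = (zeroˡ 0# , 0#⋆≈0#) , λ x → trans (zeroˡ x) (sym (zeroʳ x))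

  IsCentralProjection-1# : IsCentralProjection R 1#
  IsCentralProjection-1# =
    (*-identityˡ 1# , 1#⋆≈1#) , λ x → trans (*-identityˡ x) (sym (*-identityʳ x))

  record Complementary (h k : Carrier) : Set (c ⊔ ℓ) where
    field
      h-central : IsCentralProjection R h
      k-central : IsCentralProjection R k
      h*k≈0     : h * k ≈ 0#
      h+k≈1     : h + k ≈ 1#

  complementary : ∀ {e} → IsCentralProjection R e → Complementary e (1# - e)
  complementary {e} ((e*e≈e , e⋆≈e) , e-comm) = record
    { h-central = (e*e≈e , e⋆≈e) , e-comm
    ; k-central = (e'*e'≈e' , e'⋆≈e') , e'-comm
    ; h*k≈0     = e*e'≈0
    ; h+k≈1     = e+e'≈1
    }
    where
    e' : Carrier
    e' = 1# - e

    e*e'≈0 : e * e' ≈ 0#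
    e*e'≈0 = begin
      e * (1# - e)       ≈⟨ x[y-z]≈xy-xz e 1# e ⟩
      e * 1# - e * e     ≈⟨ +-cong (*-identityʳ e) (-‿cong e*e≈e) ⟩
      e - e              ≈⟨ -‿inverseʳ e ⟩
      0#                 ∎

    e'*e'≈e' : e' * e' ≈ e'
    e'*e'≈e' = begin
      (1# - e) * e'      ≈⟨ [y-z]x≈yx-zx e' 1# e ⟩
      1# * e' - e * e'   ≈⟨ +-cong (*-identityˡ e') (-‿cong e*e'≈0) ⟩
      e' - 0#            ≈⟨ +-congˡ -0#≈0# ⟩
      e' + 0#            ≈⟨ +-identityʳ e' ⟩
      e'                 ∎

    e'⋆≈e' : e' ⋆ ≈ e'
    e'⋆≈e' = begin
      (1# + - e) ⋆       ≈⟨ ⋆-+ 1# (- e) ⟩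
      1# ⋆ + (- e) ⋆     ≈⟨ +-cong 1#⋆≈1# (-‿⋆ e) ⟩
      1# + - (e ⋆)       ≈⟨ +-congˡ (-‿cong e⋆≈e) ⟩
      e'                 ∎

    e'-comm : ∀ x → e' * x ≈ x * e'
    e'-comm x = begin
      (1# - e) * x       ≈⟨ [y-z]x≈yx-zx x 1# e ⟩
      1# * x - e * x     ≈⟨ +-cong (*-identityˡ x) (-‿cong (e-comm x)) ⟩
      x - x * e          ≈⟨ +-congʳ (*-identityʳ x) ⟨
      x * 1# - x * e     ≈⟨ x[y-z]≈xy-xz x 1# e ⟨
      x * e'             ∎

    e+e'≈1 : e + e' ≈ 1#
    e+e'≈1 = begin
      e + (1# - e)       ≈⟨ +-congˡ (+-comm 1# (- e)) ⟩
      e + (- e + 1#)     ≈⟨ +-assoc e (- e) 1# ⟨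
      (e - e) + 1#       ≈⟨ +-congʳ (-‿inverseʳ e) ⟩
      0# + 1#            ≈⟨ +-identityˡ 1# ⟩
      1#                 ∎

  module _ {h k : Carrier} (hk : Complementary h k) where
    open Complementary hk

    complementary-sym : Complementary k h
    complementary-sym = record
      { h-central = k-central
      ; k-central = h-central
      ; h*k≈0     = trans (proj₂ k-central h) h*k≈0
      ; h+k≈1     = trans (+-comm k h) h+k≈1
      }

    x≈xh+xk : ∀ x → x ≈ x * h + x * k
    x≈xh+xk x = begin
      x                  ≈⟨ *-identityʳ x ⟨
      x * 1#             ≈⟨ *-congˡ h+k≈1 ⟨
      x * (h + k)        ≈⟨ distribˡ x h k ⟩
      x * h + x * k      ∎

    xh≈0⇒xk≈0⇒x≈0 : ∀ {x} → x * h ≈ 0# → x * k ≈ 0# → x ≈ 0#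
    xh≈0⇒xk≈0⇒x≈0 {x} xh≈0 xk≈0 =
      trans (x≈xh+xk x) (trans (+-cong xh≈0 xk≈0) (+-identityʳ 0#))

    xk≈0⇔x≈xh : ∀ x → x * k ≈ 0# ⇔ x ≈ x * h
    xk≈0⇔x≈xh x = mk⇔
      (λ xk≈0 → trans (x≈xh+xk x) (trans (+-congˡ xk≈0) (+-identityʳ (x * h))))
      (λ x≈xh → begin
        x * k            ≈⟨ *-congʳ x≈xh ⟩
        (x * h) * k      ≈⟨ *-assoc x h k ⟩
        x * (h * k)      ≈⟨ *-congˡ h*k≈0 ⟩
        x * 0#           ≈⟨ zeroʳ x ⟩
        0#               ∎)

    k≈0⇒h≈1 : k ≈ 0# → h ≈ 1#
    k≈0⇒h≈1 k≈0 = trans (sym (trans (+-congˡ k≈0) (+-identityʳ h))) h+k≈1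

    k≈1⇒h≈0 : k ≈ 1# → h ≈ 0#
    k≈1⇒h≈0 k≈1 = trans (sym (trans (*-congˡ k≈1) (*-identityʳ h))) h*k≈0

    h≈k⇒h≈0 : h ≈ k → h ≈ 0#
    h≈k⇒h≈0 h≈k =
      trans (sym (trans (*-congˡ (sym h≈k)) (proj₁ (proj₁ h-central)))) h*k≈0

  RAnnGeneratedBy : Carrier → Carrier → Set (c ⊔ ℓ)
  RAnnGeneratedBy a h = ∀ x → InRAnnAR R a x ⇔ InPrincipal R h x

  InRAnnAR-cong : ∀ {a b x} → a ≈ b → InRAnnAR R a x → InRAnnAR R b x
  InRAnnAR-cong a≈b x∈r[aR] r = trans (*-congʳ (*-congʳ (sym a≈b))) (x∈r[aR] r)

  InRAnnAR-*ˡ : ∀ {a x} → InRAnnAR R a x → ∀ y → InRAnnAR R a (y * x)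
  InRAnnAR-*ˡ {a} {x} x∈r[aR] y r = begin
    (a * r) * (y * x)   ≈⟨ *-assoc (a * r) y x ⟨
    ((a * r) * y) * x   ≈⟨ *-congʳ (*-assoc a r y) ⟩
    (a * (r * y)) * x   ≈⟨ x∈r[aR] (r * y) ⟩
    0#                  ∎

  InPrincipal-cong : ∀ {g h x} → g ≈ h → InPrincipal R g x → InPrincipal R h x
  InPrincipal-cong g≈h (y , x≈gy) = y , trans x≈gy (*-congʳ g≈h)

  InPrincipal⇔x≈hx : ∀ {h} → h * h ≈ h → ∀ x → InPrincipal R h x ⇔ x ≈ h * x
  InPrincipal⇔x≈hx {h} h*h≈h x = mk⇔
    (λ (y , x≈hy) → begin
      x                 ≈⟨ x≈hy ⟩
      h * y             ≈⟨ *-congʳ h*h≈h ⟨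
      (h * h) * y       ≈⟨ *-assoc h h y ⟩
      h * (h * y)       ≈⟨ *-congˡ x≈hy ⟨
      h * x             ∎)
    (λ x≈hx → x , x≈hx)

  RAnnGeneratedBy-congˡ : ∀ {a b h} → a ≈ b → RAnnGeneratedBy a h → RAnnGeneratedBy b h
  RAnnGeneratedBy-congˡ a≈b r[aR]=hR x =
    ⇔.trans (mk⇔ (InRAnnAR-cong (sym a≈b)) (InRAnnAR-cong a≈b)) (r[aR]=hR x)

  RAnnGeneratedBy-congʳ : ∀ {a g h} → g ≈ h → RAnnGeneratedBy a g → RAnnGeneratedBy a h
  RAnnGeneratedBy-congʳ g≈h r[aR]=gR x =
    ⇔.trans (r[aR]=gR x) (mk⇔ (InPrincipal-cong g≈h) (InPrincipal-cong (sym g≈h)))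

  RAnnGeneratedBy⇒generator∈ : ∀ {a h} → RAnnGeneratedBy a h → InRAnnAR R a h
  RAnnGeneratedBy⇒generator∈ {h = h} r[aR]=hR =
    Equivalence.from (r[aR]=hR h) (1# , sym (*-identityʳ h))

  RAnnGeneratedBy⇒ah≈0 : ∀ {a h} → RAnnGeneratedBy a h → a * h ≈ 0#
  RAnnGeneratedBy⇒ah≈0 {a} r[aR]=hR =
    trans (*-congʳ (sym (*-identityʳ a))) (RAnnGeneratedBy⇒generator∈ r[aR]=hR 1#)

  leftSemicentral⇒central : ∀ {e} → IsProjection R e → (∀ y → y * e ≈ e * (y * e)) →
                            ∀ x → e * x ≈ x * e
  leftSemicentral⇒central {e} (_ , e⋆≈e) semicentral x = begin
    e * x               ≈⟨ *-congˡ (⋆-invol x) ⟨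
    e * (x ⋆) ⋆         ≈⟨ ⋆-*-selfAdjointʳ e⋆≈e (x ⋆) ⟨
    (x ⋆ * e) ⋆         ≈⟨ ⋆-cong (semicentral (x ⋆)) ⟩
    (e * (x ⋆ * e)) ⋆   ≈⟨ ⋆-*-selfAdjointˡ e⋆≈e (x ⋆ * e) ⟩
    (x ⋆ * e) ⋆ * e     ≈⟨ *-congʳ (⋆-*-selfAdjointʳ e⋆≈e (x ⋆)) ⟩
    (e * (x ⋆) ⋆) * e   ≈⟨ *-congʳ (*-congˡ (⋆-invol x)) ⟩
    (e * x) * e         ≈⟨ *-assoc e x e ⟩
    e * (x * e)         ≈⟨ semicentral x ⟨
    x * e               ∎

  RAnnGeneratedBy⇒leftSemicentral : ∀ {a e} → e * e ≈ e → RAnnGeneratedBy a e →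
                                    ∀ y → y * e ≈ e * (y * e)
  RAnnGeneratedBy⇒leftSemicentral {e = e} e*e≈e r[aR]=eR y =
    Equivalence.to (InPrincipal⇔x≈hx e*e≈e (y * e))
      (Equivalence.to (r[aR]=eR (y * e)) (InRAnnAR-*ˡ (RAnnGeneratedBy⇒generator∈ r[aR]=eR) y))

  RAnnGeneratedBy⇒central : ∀ {a e} → IsProjection R e → RAnnGeneratedBy a e →
                            IsCentralProjection R e
  RAnnGeneratedBy⇒central e-proj r[aR]=eR =
    e-proj ,
    leftSemicentral⇒central e-proj (RAnnGeneratedBy⇒leftSemicentral (proj₁ e-proj) r[aR]=eR)

  module _ {a g : Carrier} (a-vertex : IsVertex R a) (r[aR]=gR : RAnnGeneratedBy a g) where

    vertex-generator≉0 : ¬ g ≈ 0#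
    vertex-generator≉0 g≈0 =
      let _ , x , x≉0 , x∈r[aR] = a-vertex
          y , x≈gy = Equivalence.to (r[aR]=gR x) x∈r[aR]
      in x≉0 (trans x≈gy (trans (*-congʳ g≈0) (zeroˡ y)))

    vertex-generator≉1 : ¬ g ≈ 1#
    vertex-generator≉1 g≈1 = proj₁ a-vertex (begin
      a                 ≈⟨ *-identityʳ a ⟨
      a * 1#            ≈⟨ *-congˡ g≈1 ⟨
      a * g             ≈⟨ RAnnGeneratedBy⇒ah≈0 r[aR]=gR ⟩
      0#                ∎)

  InRAnnAR-⋆⇔vk≈0 : ∀ {h k} → Complementary h k → ∀ {u} → RAnnGeneratedBy u h →
                    ∀ v → InRAnnAR R u (v ⋆) ⇔ v * k ≈ 0#
  InRAnnAR-⋆⇔vk≈0 {h} hk r[uR]=hR v =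
    ⇔.trans (r[uR]=hR (v ⋆))
      (⇔.trans (InPrincipal⇔x≈hx h*h≈h (v ⋆))
        (⇔.trans (⇔.sym (x≈xh⇔x⋆≈hx⋆ h⋆≈h v))
          (⇔.sym (xk≈0⇔x≈xh hk v))))
    where
    open Complementary hk
    h*h≈h : h * h ≈ h
    h*h≈h = proj₁ (proj₁ h-central)
    h⋆≈h : h ⋆ ≈ h
    h⋆≈h = proj₂ (proj₁ h-central)

  complementary-vertex : ∀ {h k} → Complementary h k → ¬ h ≈ 0# → ¬ k ≈ 0# →
                         IsVertex R k
  complementary-vertex {h} {k} hk h≉0 k≉0 = k≉0 , h , h≉0 , h∈r[kR]
    where
    open Complementary hk
    k*h≈0 : k * h ≈ 0#
    k*h≈0 = Complementary.h*k≈0 (complementary-sym hk)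
    h∈r[kR] : InRAnnAR R k h
    h∈r[kR] r = begin
      (k * r) * h       ≈⟨ *-assoc k r h ⟩
      k * (r * h)       ≈⟨ *-congˡ (proj₂ h-central r) ⟨
      k * (h * r)       ≈⟨ *-assoc k h r ⟨
      (k * h) * r       ≈⟨ *-congʳ k*h≈0 ⟩
      0# * r            ≈⟨ zeroˡ r ⟩
      0#                ∎

  module _ {h k : Carrier} (hk : Complementary h k) (h≉0 : ¬ h ≈ 0#) (k≉0 : ¬ k ≈ 0#)
           (generator-cases : ∀ a → IsVertex R a →
                              RAnnGeneratedBy a h ⊎ RAnnGeneratedBy a k) where

    private
      kh : Complementary k h
      kh = complementary-sym hk

      Vertex : Set (c ⊔ ℓ)
      Vertex = Σ Carrier (IsVertex R)

      V₁ V₂ : Vertex → Set (c ⊔ ℓ)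
      V₁ v = RAnnGeneratedBy (proj₁ v) h
      V₂ v = RAnnGeneratedBy (proj₁ v) k

      disjoint : ∀ v → V₁ v → V₂ v → ⊥
      disjoint (_ , a≉0 , _) a∈V₁ a∈V₂ =
        a≉0 (xh≈0⇒xk≈0⇒x≈0 hk (RAnnGeneratedBy⇒ah≈0 a∈V₁) (RAnnGeneratedBy⇒ah≈0 a∈V₂))

      cover : ∀ v → V₁ v ⊎ V₂ v
      cover (a , a-vertex) = generator-cases a a-vertex

      ah≈0⇒V₁ : ∀ v → proj₁ v * h ≈ 0# → V₁ v
      ah≈0⇒V₁ v@(_ , a≉0 , _) ah≈0 with cover v
      ... | inj₁ v∈V₁ = v∈V₁
      ... | inj₂ v∈V₂ =
        contradiction (xh≈0⇒xk≈0⇒x≈0 hk ah≈0 (RAnnGeneratedBy⇒ah≈0 v∈V₂)) a≉0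

      ak≈0⇒V₂ : ∀ v → proj₁ v * k ≈ 0# → V₂ v
      ak≈0⇒V₂ v@(_ , a≉0 , _) ak≈0 with cover v
      ... | inj₁ v∈V₁ =
        contradiction (xh≈0⇒xk≈0⇒x≈0 hk (RAnnGeneratedBy⇒ah≈0 v∈V₁) ak≈0) a≉0
      ... | inj₂ v∈V₂ = v∈V₂

      k-vertex : Vertex
      k-vertex = k , complementary-vertex hk h≉0 k≉0

      h-vertex : Vertex
      h-vertex = h , complementary-vertex kh k≉0 h≉0

      adjacent⇔ : ∀ u v → Graph.E (strongZDGraph R) u v ⇔
                          ((V₁ u × V₂ v) ⊎ (V₂ u × V₁ v))
      adjacent⇔ u@(a , _) v@(b , _) = mk⇔ to from
        where
        to : Graph.E (strongZDGraph R) u v → (V₁ u × V₂ v) ⊎ (V₂ u × V₁ v)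
        to (_ , b⋆∈r[aR]) with cover u
        ... | inj₁ u∈V₁ =
          inj₁ (u∈V₁ , ak≈0⇒V₂ v (Equivalence.to (InRAnnAR-⋆⇔vk≈0 hk u∈V₁ b) b⋆∈r[aR]))
        ... | inj₂ u∈V₂ =
          inj₂ (u∈V₂ , ah≈0⇒V₁ v (Equivalence.to (InRAnnAR-⋆⇔vk≈0 kh u∈V₂ b) b⋆∈r[aR]))

        from : (V₁ u × V₂ v) ⊎ (V₂ u × V₁ v) → Graph.E (strongZDGraph R) u v
        from (inj₁ (u∈V₁ , v∈V₂)) =
          (λ a≈b → disjoint v (RAnnGeneratedBy-congˡ a≈b u∈V₁) v∈V₂) ,
          Equivalence.from (InRAnnAR-⋆⇔vk≈0 hk u∈V₁ b) (RAnnGeneratedBy⇒ah≈0 v∈V₂)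
        from (inj₂ (u∈V₂ , v∈V₁)) =
          (λ a≈b → disjoint v v∈V₁ (RAnnGeneratedBy-congˡ a≈b u∈V₂)) ,
          Equivalence.from (InRAnnAR-⋆⇔vk≈0 kh u∈V₂ b) (RAnnGeneratedBy⇒ah≈0 v∈V₁)

    complementary-generators⇒completeBipartite : IsCompleteBipartite (strongZDGraph R)
    complementary-generators⇒completeBipartite =
      V₁ , V₂ , RAnnGeneratedBy-congˡ , RAnnGeneratedBy-congˡ ,
      (k-vertex , ah≈0⇒V₁ k-vertex (Complementary.h*k≈0 kh)) ,
      (h-vertex , ak≈0⇒V₂ h-vertex (Complementary.h*k≈0 hk)) ,
      cover , disjoint , adjacent⇔

  module FourCentralProjections (cp4 : CPHasFourElements R) where

    private
      f : Fin 4 → Carrier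
      f = proj₁ cp4

      f-central : ∀ i → IsCentralProjection R (f i)
      f-central = proj₁ (proj₂ cp4)

      f-injective : ∀ i j → f i ≈ f j → i ≡ j
      f-injective = proj₁ (proj₂ (proj₂ cp4))

      f-surjective : ∀ g → IsCentralProjection R g → ∃ λ i → g ≈ f i
      f-surjective = proj₂ (proj₂ (proj₂ cp4))

      index≢ : ∀ {x y i j} → x ≈ f i → y ≈ f j → ¬ x ≈ y → i ≢ j
      index≢ x≈fi y≈fj x≉y ≡.refl = x≉y (trans x≈fi (sym y≈fj))

      i₀ i₁ : Fin 4
      i₀ = proj₁ (f-surjective 0# IsCentralProjection-0#)
      i₁ = proj₁ (f-surjective 1# IsCentralProjection-1#)

      0≈fi₀ : 0# ≈ f i₀
      0≈fi₀ = proj₂ (f-surjective 0# IsCentralProjection-0#)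

      1≈fi₁ : 1# ≈ f i₁
      1≈fi₁ = proj₂ (f-surjective 1# IsCentralProjection-1#)

      0≉1 : ¬ 0# ≈ 1#
      0≉1 0≈1 = contradiction (f-injective Fin.zero (Fin.suc Fin.zero) f₀≈f₁) λ ()
        where
        f₀≈f₁ : f Fin.zero ≈ f (Fin.suc Fin.zero)
        f₀≈f₁ = trans (0≈1⇒x≈0 0≈1 _) (sym (0≈1⇒x≈0 0≈1 _))

      j : Fin 4
      j = proj₁ (avoid₂ i₀ i₁)

      j≢i₀ : j ≢ i₀
      j≢i₀ = proj₁ (proj₂ (avoid₂ i₀ i₁))

      j≢i₁ : j ≢ i₁
      j≢i₁ = proj₂ (proj₂ (avoid₂ i₀ i₁))

    e e' : Carrier
    e  = f j
    e' = 1# - e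

    e-complementary : Complementary e e'
    e-complementary = complementary (f-central j)

    e≉0 : ¬ e ≈ 0#
    e≉0 e≈0 = j≢i₀ (f-injective j i₀ (trans e≈0 0≈fi₀))

    e≉1 : ¬ e ≈ 1#
    e≉1 e≈1 = j≢i₁ (f-injective j i₁ (trans e≈1 1≈fi₁))

    e'≉0 : ¬ e' ≈ 0#
    e'≉0 = e≉1 ∘ k≈0⇒h≈1 e-complementary

    private
      e'≉1 : ¬ e' ≈ 1#
      e'≉1 = e≉0 ∘ k≈1⇒h≈0 e-complementary

      p : Fin 4
      p = proj₁ (f-surjective e' (Complementary.k-central e-complementary))

      e'≈fp : e' ≈ f p
      e'≈fp = proj₂ (f-surjective e' (Complementary.k-central e-complementary))

      indices-unique : Unique (i₀ ∷ i₁ ∷ j ∷ p ∷ [])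
      indices-unique =
        (index≢ 0≈fi₀ 1≈fi₁ 0≉1 ∷ ≢-sym j≢i₀ ∷ index≢ 0≈fi₀ e'≈fp (e'≉0 ∘ sym) ∷ []) ∷
        (≢-sym j≢i₁ ∷ index≢ 1≈fi₁ e'≈fp (e'≉1 ∘ sym) ∷ []) ∷
        (index≢ refl e'≈fp (e≉0 ∘ h≈k⇒h≈0 e-complementary) ∷ []) ∷
        [] ∷
        []

      index-cases : ∀ {g m} → g ≈ f m → m ∈ (i₀ ∷ i₁ ∷ j ∷ p ∷ []) →
                    g ≈ 0# ⊎ g ≈ 1# ⊎ g ≈ e ⊎ g ≈ e'
      index-cases g≈fm (here ≡.refl)                         = inj₁ (trans g≈fm (sym 0≈fi₀))
      index-cases g≈fm (there (here ≡.refl))                 = inj₂ (inj₁ (trans g≈fm (sym 1≈fi₁)))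
      index-cases g≈fm (there (there (here ≡.refl)))         = inj₂ (inj₂ (inj₁ g≈fm))
      index-cases g≈fm (there (there (there (here ≡.refl)))) = inj₂ (inj₂ (inj₂ (trans g≈fm (sym e'≈fp))))

    centralProjection-cases : ∀ {g} → IsCentralProjection R g →
                              g ≈ 0# ⊎ g ≈ 1# ⊎ g ≈ e ⊎ g ≈ e'
    centralProjection-cases {g} g-central =
      let m , g≈fm = f-surjective g g-central
      in index-cases g≈fm (unique-full⇒∈ indices-unique ≡.refl m)

  module _ (pq : IsPQBaer R) (cp4 : CPHasFourElements R) where
    open FourCentralProjections cp4

    vertex-generator-cases : ∀ a → IsVertex R a → RAnnGeneratedBy a e ⊎ RAnnGeneratedBy a e'
    vertex-generator-cases a a-vertex =
      let g , g-projection , r[aR]=gR = pq a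
      in classify r[aR]=gR (centralProjection-cases (RAnnGeneratedBy⇒central g-projection r[aR]=gR))
      where
      classify : ∀ {g} → RAnnGeneratedBy a g → g ≈ 0# ⊎ g ≈ 1# ⊎ g ≈ e ⊎ g ≈ e' →
                 RAnnGeneratedBy a e ⊎ RAnnGeneratedBy a e'
      classify r[aR]=gR (inj₁ g≈0)                =
        contradiction g≈0 (vertex-generator≉0 a-vertex r[aR]=gR)
      classify r[aR]=gR (inj₂ (inj₁ g≈1))         =
        contradiction g≈1 (vertex-generator≉1 a-vertex r[aR]=gR)
      classify r[aR]=gR (inj₂ (inj₂ (inj₁ g≈e)))  = inj₁ (RAnnGeneratedBy-congʳ g≈e r[aR]=gR)
      classify r[aR]=gR (inj₂ (inj₂ (inj₂ g≈e'))) = inj₂ (RAnnGeneratedBy-congʳ g≈e' r[aR]=gR)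

proposition4p5 : {c ℓ : Level} (R : StarRing c ℓ) → IsPQBaer R → CPHasFourElements R →
    IsCompleteBipartite (strongZDGraph R) × IsDisconnected (complement (strongZDGraph R))
proposition4p5 R pq cp4 =
  completeBipartite , completeBipartite⇒complement-disconnected (strongZDGraph R) completeBipartite
  where
  open FourCentralProjections R cp4

  completeBipartite : IsCompleteBipartite (strongZDGraph R)
  completeBipartite =
    complementary-generators⇒completeBipartite R e-complementary e≉0 e'≉0
      (vertex-generator-cases R pq cp4)
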